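{- Let $x, y, z$ be positive integers and let $b = \frac{(x+y+z)^2}{xyz}$. If $b \in \mathbb{Z}$, then $b \le 9$ and $b \ne 7$. -}

module Defs where

{-# OPTIONS --safe #-}
module Submission where

-- Vieta jumping. For fixed y and z the equation is quadratic in x, and its other root (y + z)² / x
-- is again a positive solution, smaller than x whenever x > y + z. Descending on x + y + z, every
-- solution leads to a fundamental one, d ≤ c ≤ a ≤ c + d, with the same b. If b ≥ 7 then
-- 7c²d ≤ (a + c + d)² ≤ (2c + 2d)², which forces d ≤ 2, c ≤ 6 and a ≤ 8, and the finitely many
-- such triples give (a + c + d)² ≠ 7acd and (a + c + d)² < 10acd.

open import Defs
open import Data.Nat using (ℕ; _+_; _*_; _^_; _≤_; _<_)
open import Data.Product using (_×_)
open import Relation.Binary.PropositionalEquality using (_≡_; _≢_)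

open import Data.Nat using (s≤s; z<s; NonZero; >-nonZero; _≤?_; _<?_; _≟_)
open import Data.Nat.Properties
open import Data.Nat.Divisibility using (_∣_; ∣m+n∣m⇒∣n; m∣m*n)
open import Data.Nat.Induction using (<-rec)
open import Data.Nat.Solver using (module +-*-Solver)
open import Data.Product using (_,_; proj₁; proj₂; ∃-syntax)
open import Data.Sum using (inj₁; inj₂)
open import Relation.Nullary using (yes; no; ¬?; contradiction)
open import Relation.Nullary.Decidable using (from-yes; _×-dec_; _→-dec_)
open import Relation.Binary.PropositionalEquality using (refl; sym; trans; cong; subst; subst₂; module ≡-Reasoning)
import Algebra.Properties.CommutativeSemigroup as CommutativeSemigroupProperties

open +-*-Solver using (solve; _:+_; _:*_; _:^_; _:=_; con)
module + = CommutativeSemigroupProperties +-commutativeSemigroup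
module * = CommutativeSemigroupProperties *-commutativeSemigroup

square-expand : ∀ r s → (r + s) ^ 2 ≡ r * (r + 2 * s) + s ^ 2
square-expand = solve 2 (λ r s → (r :+ s) :^ 2 := r :* (r :+ con 2 :* s) :+ s :^ 2) refl

-- (r + s)² = r m says that r is a root of t² + (2s − m) t + s², whose roots multiply to s².
vieta-other-root : ∀ {r r′ s m} → 0 < r → s ^ 2 ≡ r′ * r →
                   (r + s) ^ 2 ≡ r * m → (r′ + s) ^ 2 ≡ r′ * m
vieta-other-root {r} {r′} {s} {m} r>0 s²≡r′r r-root = begin
  (r′ + s) ^ 2               ≡⟨ square-expand r′ s ⟩
  r′ * (r′ + 2 * s) + s ^ 2  ≡⟨ cong (r′ * (r′ + 2 * s) +_) s²≡r′r ⟩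
  r′ * (r′ + 2 * s) + r′ * r ≡⟨ *-distribˡ-+ r′ (r′ + 2 * s) r ⟨
  r′ * (r′ + 2 * s + r)      ≡⟨ cong (r′ *_) root-sum ⟩
  r′ * m                     ∎
  where
  open ≡-Reasoning
  root-sum : r′ + 2 * s + r ≡ m
  root-sum = *-cancelˡ-≡ _ _ r ⦃ >-nonZero r>0 ⦄ (begin
    r * (r′ + 2 * s + r)     ≡⟨ solve 3 (λ r r′ s → r :* (r′ :+ con 2 :* s :+ r)
                                                 := r :* (r :+ con 2 :* s) :+ r′ :* r) refl r r′ s ⟩
    r * (r + 2 * s) + r′ * r ≡⟨ cong (r * (r + 2 * s) +_) s²≡r′r ⟨
    r * (r + 2 * s) + s ^ 2  ≡⟨ square-expand r s ⟨
    (r + s) ^ 2              ≡⟨ r-root ⟩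
    r * m                    ∎)

record Solution (b x y z : ℕ) : Set where
  constructor mkSolution
  field
    x>0      : 0 < x
    y>0      : 0 < y
    z>0      : 0 < z
    equation : (x + y + z) ^ 2 ≡ b * (x * y * z)

module _ {b x y z : ℕ} where

  solution-swap : Solution b x y z → Solution b y x z
  solution-swap (mkSolution x>0 y>0 z>0 eq) =
    mkSolution y>0 x>0 z>0 (subst₂ (λ s p → s ^ 2 ≡ b * p) (+.xy∙z≈yx∙z x y z) (*.xy∙z≈yx∙z x y z) eq)

  solution-rotate : Solution b x y z → Solution b y z x
  solution-rotate (mkSolution x>0 y>0 z>0 eq) =
    mkSolution y>0 z>0 x>0 (subst₂ (λ s p → s ^ 2 ≡ b * p) (+.xy∙z≈yz∙x x y z) (*.xy∙z≈yz∙x x y z) eq)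

vieta-jump : ∀ {b x y z} → Solution b x y z → y + z < x → ∃[ x′ ] x′ < x × Solution b x′ y z
vieta-jump {b} {x} {y} {z} (mkSolution x>0 y>0 z>0 eq) y+z<x =
  x′ , x′<x , mkSolution x′>0 y>0 z>0 (from-quadratic x′ x′-root)
  where
  s m : ℕ
  s = y + z
  m = b * (y * z)

  pull-out : ∀ t → b * (t * y * z) ≡ t * m
  pull-out t = trans (cong (b *_) (*-assoc t y z)) (*.x∙yz≈y∙xz b t (y * z))

  to-quadratic : ∀ t → (t + y + z) ^ 2 ≡ b * (t * y * z) → (t + s) ^ 2 ≡ t * m
  to-quadratic t = subst₂ (λ u v → u ^ 2 ≡ v) (+-assoc t y z) (pull-out t)

  from-quadratic : ∀ t → (t + s) ^ 2 ≡ t * m → (t + y + z) ^ 2 ≡ b * (t * y * z)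
  from-quadratic t = subst₂ (λ u v → u ^ 2 ≡ v) (sym (+-assoc t y z)) (sym (pull-out t))

  x∣s² : x ∣ s ^ 2
  x∣s² = ∣m+n∣m⇒∣n (subst (x ∣_) (trans (sym (to-quadratic x eq)) (square-expand x s)) (m∣m*n m))
                   (m∣m*n (x + 2 * s))

  open _∣_ x∣s² renaming (quotient to x′; equality to s²≡x′x)

  s²>0 : 0 < s ^ 2
  s²>0 = m^n>0 s ⦃ >-nonZero (<-≤-trans y>0 (m≤m+n y z)) ⦄ 2

  x′>0 : 0 < x′
  x′>0 = *-cancelʳ-< x 0 x′ (subst (0 <_) s²≡x′x s²>0)

  x′-root : (x′ + s) ^ 2 ≡ x′ * m
  x′-root = vieta-other-root {r′ = x′} {s} {m} x>0 s²≡x′x (to-quadratic x eq)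

  x′<x : x′ < x
  x′<x = *-cancelʳ-< x x′ x (subst₂ _<_ s²≡x′x (cong (x *_) (*-identityʳ x)) (^-monoˡ-< 2 y+z<x))

module _ {P : ℕ → ℕ → ℕ → Set}
         (swap : ∀ {x y z} → P x y z → P y x z)
         (rotate : ∀ {x y z} → P x y z → P y z x) where

  wlog-descending : (∀ {x y z} → y ≤ x → z ≤ y → P x y z) → ∀ x y z → P x y z
  wlog-descending P↓ x y z with ≤-total y x | ≤-total z y | ≤-total z x
  ... | inj₁ y≤x | inj₁ z≤y | _        = P↓ y≤x z≤y
  ... | inj₁ y≤x | inj₂ y≤z | inj₁ z≤x = rotate (swap (P↓ z≤x y≤z))
  ... | inj₁ y≤x | inj₂ y≤z | inj₂ x≤z = rotate (P↓ x≤z y≤x)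
  ... | inj₂ x≤y | inj₁ z≤y | inj₁ z≤x = swap (P↓ x≤y z≤x)
  ... | inj₂ x≤y | inj₁ z≤y | inj₂ x≤z = rotate (rotate (P↓ z≤y x≤z))
  ... | inj₂ x≤y | inj₂ y≤z | _        = swap (rotate (P↓ y≤z x≤y))

record FundamentalSolution (b : ℕ) : Set where
  field
    {a c d}  : ℕ
    solution : Solution b a c d
    d≤c      : d ≤ c
    c≤a      : c ≤ a
    a≤c+d    : a ≤ c + d

fundamental-solution : ∀ {b x y z} → Solution b x y z → FundamentalSolution b
fundamental-solution {b} {x} {y} {z} = <-rec ReachesFundamental step (x + y + z) x y z refl
  where
  ReachesFundamentalFrom : ℕ → ℕ → ℕ → ℕ → Set
  ReachesFundamentalFrom n x y z = x + y + z ≡ n → Solution b x y z → FundamentalSolution b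

  ReachesFundamental : ℕ → Set
  ReachesFundamental n = ∀ x y z → ReachesFundamentalFrom n x y z

  step : ∀ n → (∀ {n′} → n′ < n → ReachesFundamental n′) → ReachesFundamental n
  step n reaches = wlog-descending swap rotate descending
    where
    swap : ∀ {x y z} → ReachesFundamentalFrom n x y z → ReachesFundamentalFrom n y x z
    swap {x} {y} {z} f sum≡n sol = f (trans (+.xy∙z≈yx∙z x y z) sum≡n) (solution-swap sol)

    rotate : ∀ {x y z} → ReachesFundamentalFrom n x y z → ReachesFundamentalFrom n y z x
    rotate {x} {y} {z} f sum≡n sol =
      f (trans (+.xy∙z≈yz∙x x y z) sum≡n) (solution-rotate (solution-rotate sol))

    descending : ∀ {x y z} → y ≤ x → z ≤ y → ReachesFundamentalFrom n x y z
    descending {x} {y} {z} y≤x z≤y refl sol with x ≤? y + z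
    ... | yes x≤y+z = record { solution = sol ; d≤c = z≤y ; c≤a = y≤x ; a≤c+d = x≤y+z }
    ... | no x≰y+z =
      let x′ , x′<x , sol′ = vieta-jump sol (≰⇒> x≰y+z)
      in  reaches (+-monoˡ-< z (+-monoˡ-< y x′<x)) x′ y z refl sol′

module _ {c d : ℕ} where
  open ≤-Reasoning

  7c²d≤[2c+2d]²⇒d<3 : .⦃ _ : NonZero c ⦄ → d ≤ c → 7 * (c * c * d) ≤ (c + d + c + d) ^ 2 → d < 3
  7c²d≤[2c+2d]²⇒d<3 d≤c 7c²d≤[2c+2d]² = *-cancelˡ-< 7 d 3 (≤-<-trans 7d≤16 (from-yes (16 <? 21)))
    where
    7d≤16 : 7 * d ≤ 16
    7d≤16 = *-cancelʳ-≤ (7 * d) 16 (c * c) ⦃ m*n≢0 c c ⦄ (begin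
      7 * d * (c * c)     ≡⟨ solve 2 (λ c d → con 7 :* d :* (c :* c) := con 7 :* (c :* c :* d)) refl c d ⟩
      7 * (c * c * d)     ≤⟨ 7c²d≤[2c+2d]² ⟩
      (c + d + c + d) ^ 2 ≤⟨ ^-monoˡ-≤ 2 (+-mono-≤ (+-monoˡ-≤ c (+-monoʳ-≤ c d≤c)) d≤c) ⟩
      (c + c + c + c) ^ 2 ≡⟨ solve 1 (λ c → (c :+ c :+ c :+ c) :^ 2 := con 16 :* (c :* c)) refl c ⟩
      16 * (c * c)        ∎)

  7c²d≤[2c+2d]²⇒c<7 : 0 < d → d < 3 → 7 * (c * c * d) ≤ (c + d + c + d) ^ 2 → c < 7
  7c²d≤[2c+2d]²⇒c<7 d>0 d<3 7c²d≤[2c+2d]² with c <? 7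
  ... | yes c<7 = c<7
  ... | no c≮7 = contradiction 7c²≤[2c+4]² (<⇒≱ ([2c+4]²<7c² (≮⇒≥ c≮7)))
    where
    7c²≤[2c+4]² : 7 * (c * c) ≤ (c + 2 + c + 2) ^ 2
    7c²≤[2c+4]² = begin
      7 * (c * c)         ≤⟨ *-monoʳ-≤ 7 (m≤m*n (c * c) d ⦃ >-nonZero d>0 ⦄) ⟩
      7 * (c * c * d)     ≤⟨ 7c²d≤[2c+2d]² ⟩
      (c + d + c + d) ^ 2 ≤⟨ ^-monoˡ-≤ 2 (+-mono-≤ (+-monoˡ-≤ c (+-monoʳ-≤ c d≤2)) d≤2) ⟩
      (c + 2 + c + 2) ^ 2 ∎
      where
      d≤2 : d ≤ 2
      d≤2 = ≤-pred d<3
    [2c+4]²<7c² : 7 ≤ c → (c + 2 + c + 2) ^ 2 < 7 * (c * c)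
    [2c+4]²<7c² 7≤c with m≤n⇒∃[o]m+o≡n 7≤c
    ... | k , refl = begin-strict
      (7 + k + 2 + (7 + k) + 2) ^ 2                                <⟨ m<m+n _ z<s ⟩
      (7 + k + 2 + (7 + k) + 2) ^ 2 + (19 + 26 * k + 3 * (k * k)) ≡⟨ expand ⟨
      7 * ((7 + k) * (7 + k))                                      ∎
      where
      expand : 7 * ((7 + k) * (7 + k)) ≡ (7 + k + 2 + (7 + k) + 2) ^ 2 + (19 + 26 * k + 3 * (k * k))
      expand = solve 1 (λ k → con 7 :* ((con 7 :+ k) :* (con 7 :+ k))
                          := (con 7 :+ k :+ con 2 :+ (con 7 :+ k) :+ con 2) :^ 2
                             :+ (con 19 :+ con 26 :* k :+ con 3 :* (k :* k))) refl k

small-fundamental-triples : ∀ {a} → a < 10 → ∀ {c} → c < 7 → ∀ {d} → d < 3 →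
                            0 < d → d ≤ c → c ≤ a → a ≤ c + d →
                            (a + c + d) ^ 2 ≢ 7 * (a * c * d) × (a + c + d) ^ 2 < 10 * (a * c * d)
small-fundamental-triples = from-yes (allUpTo? (λ a → allUpTo? (λ c → allUpTo? (λ d →
  0 <? d →-dec d ≤? c →-dec c ≤? a →-dec a ≤? c + d →-dec
  ¬? ((a + c + d) ^ 2 ≟ 7 * (a * c * d)) ×-dec (a + c + d) ^ 2 <? 10 * (a * c * d)) 3) 7) 10)

fundamental-solution-7≤b : ∀ {b} → 7 ≤ b → FundamentalSolution b → b ≤ 9 × b ≢ 7
fundamental-solution-7≤b {b} 7≤b fs =
  ≤-pred (*-cancelʳ-< (a * c * d) b 10 (subst (_< 10 * (a * c * d)) equation s²<10p)) ,
  λ { refl → s²≢7p equation }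
  where
  open FundamentalSolution fs
  open Solution solution using (equation) renaming (y>0 to c>0; z>0 to d>0)
  open ≤-Reasoning

  7c²d≤[2c+2d]² : 7 * (c * c * d) ≤ (c + d + c + d) ^ 2
  7c²d≤[2c+2d]² = begin
    7 * (c * c * d)     ≤⟨ *-mono-≤ 7≤b (*-monoˡ-≤ d (*-monoˡ-≤ c c≤a)) ⟩
    b * (a * c * d)     ≡⟨ equation ⟨
    (a + c + d) ^ 2     ≤⟨ ^-monoˡ-≤ 2 (+-monoˡ-≤ d (+-monoˡ-≤ c a≤c+d)) ⟩
    (c + d + c + d) ^ 2 ∎

  d<3 : d < 3
  d<3 = 7c²d≤[2c+2d]²⇒d<3 ⦃ >-nonZero c>0 ⦄ d≤c 7c²d≤[2c+2d]²

  c<7 : c < 7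
  c<7 = 7c²d≤[2c+2d]²⇒c<7 d>0 d<3 7c²d≤[2c+2d]²

  a<10 : a < 10
  a<10 = ≤-<-trans a≤c+d (+-mono-< c<7 d<3)

  s²≢7p : (a + c + d) ^ 2 ≢ 7 * (a * c * d)
  s²≢7p = proj₁ (small-fundamental-triples a<10 c<7 d<3 d>0 d≤c c≤a a≤c+d)

  s²<10p : (a + c + d) ^ 2 < 10 * (a * c * d)
  s²<10p = proj₂ (small-fundamental-triples a<10 c<7 d<3 d>0 d≤c c≤a a≤c+d)

fundamental-solution-bound : ∀ {b} → FundamentalSolution b → b ≤ 9 × b ≢ 7
fundamental-solution-bound {b} fs with b ≤? 6
... | yes b≤6 = ≤-trans b≤6 (m≤m+n 6 3) , <⇒≢ (s≤s b≤6)
... | no b≰6 = fundamental-solution-7≤b (≰⇒> b≰6) fs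

lemma1p2 : (x y z : ℕ) → 0 < x → 0 < y → 0 < z →
    (b : ℕ) → (x + y + z) ^ 2 ≡ b * (x * y * z) →
    b ≤ 9 × b ≢ 7
lemma1p2 x y z x>0 y>0 z>0 b eq =
  fundamental-solution-bound (fundamental-solution (mkSolution x>0 y>0 z>0 eq))
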